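{- For every positive integer $n$, $\mathrm{sat}^*(n,\Diamond')\le 2n$.
   Context: $\Diamond'$ is the poset on five elements $A,B,B',C,C'$ generated by the relations $A<B<C$, $A<B'<C$ and $B'<C'$ (so $A<C'$ by transitivity), with $B,B'$ incomparable, $C,C'$ incomparable, and $B,C'$ incomparable. A subfamily $\mathcal G\subseteq\mathcal F\subseteq 2^{[n]}$ is an induced copy of a poset $P$ if there is a bijection $i:P\to\mathcal G$ with $p\le_P q$ iff $i(p)\subseteq i(q)$; $\mathcal F$ is induced $P$-saturating if it has no induced copy of $P$ and adding any $G\in2^{[n]}\setminus\mathcal F$ creates one. $\mathrm{sat}^*(n,P)$ is the minimum size of an induced $P$-saturating family in $2^{[n]}$. -}

module Defs where

open import Data.Nat using (ℕ)
open import Data.Fin.Subset using (Subset; _⊆_)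
open import Data.List using (List; _∷_)
open import Data.List.Membership.Propositional using (_∈_)
open import Data.List.Relation.Unary.Unique.Propositional using (Unique)
open import Data.Product using (_×_; Σ)
open import Relation.Nullary using (¬_)
open import Relation.Binary.PropositionalEquality using (_≡_)
open import Relation.Binary.Construct.Closure.ReflexiveTransitive using (Star)

data Dia' : Set where
  A B B' C C' : Dia'

data _⋖_ : Dia' → Dia' → Set where
  A⋖B   : A ⋖ B
  B⋖C   : B ⋖ C
  A⋖B'  : A ⋖ B'
  B'⋖C  : B' ⋖ C
  B'⋖C' : B' ⋖ C'

_≤◇_ : Dia' → Dia' → Set
_≤◇_ = Star _⋖_

-- A family of subsets of [n] is a duplicate-free list of subsets
Family : ℕ → Set
Family n = List (Subset n)

record InducedCopy {n : ℕ} (F : Family n) : Set where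
  field
    emb      : Dia' → Subset n
    emb-∈    : ∀ p → emb p ∈ F
    emb-inj  : ∀ p q → emb p ≡ emb q → p ≡ q
    emb-mono : ∀ p q → p ≤◇ q → emb p ⊆ emb q
    emb-refl : ∀ p q → emb p ⊆ emb q → p ≤◇ q

record InducedSaturating {n : ℕ} (F : Family n) : Set where
  field
    distinct  : Unique F
    free      : ¬ InducedCopy F
    saturated : ∀ (G : Subset n) → ¬ (G ∈ F) → InducedCopy (G ∷ F)

-- The family consists of ∅, the n singletons and the n − 1 initial segments
-- [0, t) with 2 ≤ t ≤ n.  In an induced copy of ◇', the images of C and C'
-- each lie strictly above a nonempty member, so both are initial segments;
-- but initial segments form a chain, while C and C' are incomparable.  A set
-- G outside the family is nonempty with a maximum M; since G is neither {M}
-- nor [0, M], some g < M lies in G and some h < M does not, and then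
-- A ↦ ∅, B ↦ {M}, B' ↦ {g}, C ↦ G, C' ↦ [0, M) is an induced copy of ◇'.
module Submission where

open import Defs
open import Data.Bool using (Bool; true; false; T)
open import Data.Empty using (⊥-elim; ⊥-elim-irr)
open import Data.Fin using (Fin; toℕ; fromℕ<; _≟_) renaming (zero to fzero; suc to fsuc)
open import Data.Fin.Properties using (toℕ<n; toℕ-fromℕ<; ≤∧≢⇒<; <⇒≢; any?)
open import Data.Fin.Subset using (Subset; inside; _∈_; _∉_; _⊆_; _⊈_; ⁅_⁆; Nonempty)
  renaming (⊥ to ∅)
open import Data.Fin.Subset.Properties
  using (_∈?_; nonempty?; Empty-unique; ⊆-refl; ⊆-antisym; ⊆-reflexive; x∈⁅x⁆; x∈⁅y⁆⇒x≡y; x≢y⇒x∉⁅y⁆)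
  renaming (∉⊥ to ∉∅; ⊥⊆ to ∅⊆)
open import Data.List using (List; _∷_; _++_; map; length; allFin; applyUpTo)
open import Data.List.Properties using (length-++; length-map; length-tabulate; length-applyUpTo)
open import Data.List.Membership.Propositional using () renaming (_∈_ to _∈ₗ_; _∉_ to _∉ₗ_)
open import Data.List.Membership.Propositional.Properties
  using (∈-map⁺; ∈-map⁻; ∈-++⁺ˡ; ∈-++⁺ʳ; ∈-++⁻; ∈-allFin; ∈-applyUpTo⁺; ∈-applyUpTo⁻)
open import Data.List.Relation.Unary.Any as Any using ()
import Data.List.Relation.Unary.All as All
open import Data.List.Relation.Unary.AllPairs using (_∷_)
open import Data.List.Relation.Unary.Unique.Propositional using (Unique)
open import Data.List.Relation.Binary.Disjoint.Propositional using (Disjoint)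
open import Data.List.Relation.Unary.Unique.Propositional.Properties
  using (map⁺; ++⁺; allFin⁺; applyUpTo⁺₁)
open import Data.Nat using (ℕ; zero; suc; _≤_; _<_; _+_; _*_; NonZero; z≤n; s≤s; s≤s⁻¹; ≢-nonZero⁻¹)
import Data.Nat as ℕ
open import Data.Nat.Properties using (≤-trans; <-≤-trans; <⇒≤; ≤-total; <-irrefl; ≤-reflexive)
open import Data.Nat.Tactic.RingSolver using (solve-∀)
open import Data.Product using (Σ; ∃-syntax; _×_; _,_)
open import Data.Sum using (_⊎_; inj₁; inj₂)
open import Data.Vec using ([]; _∷_; here; there)
open import Function using (id; _∘_)
open import Relation.Binary.Construct.Closure.ReflexiveTransitive using (ε; _◅_)
open import Relation.Binary.PropositionalEquality
  using (_≡_; _≢_; refl; sym; trans; cong; cong₂; subst; subst₂; module ≡-Reasoning)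
open import Relation.Nullary using (¬_; yes; no; ¬?)
open import Relation.Nullary.Decidable using (_×-dec_)

infix 4 _≤ᵇ_

_≤ᵇ_ : Dia' → Dia' → Bool
A  ≤ᵇ _  = true
B  ≤ᵇ B  = true
B  ≤ᵇ C  = true
B' ≤ᵇ B' = true
B' ≤ᵇ C  = true
B' ≤ᵇ C' = true
C  ≤ᵇ C  = true
C' ≤ᵇ C' = true
_  ≤ᵇ _  = false

≤ᵇ-refl : ∀ p → T (p ≤ᵇ p)
≤ᵇ-refl A  = _
≤ᵇ-refl B  = _
≤ᵇ-refl B' = _
≤ᵇ-refl C  = _
≤ᵇ-refl C' = _

≤ᵇ-stepˡ : ∀ {p q} r → p ⋖ q → T (q ≤ᵇ r) → T (p ≤ᵇ r)
≤ᵇ-stepˡ r A⋖B   _ = _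
≤ᵇ-stepˡ r A⋖B'  _ = _
≤ᵇ-stepˡ C B⋖C   _ = _
≤ᵇ-stepˡ C B'⋖C  _ = _
≤ᵇ-stepˡ C' B'⋖C' _ = _

≤ᵇ-sound : ∀ {p q} → p ≤◇ q → T (p ≤ᵇ q)
≤ᵇ-sound {p} ε          = ≤ᵇ-refl p
≤ᵇ-sound {q = r} (s ◅ t) = ≤ᵇ-stepˡ r s (≤ᵇ-sound t)

≤ᵇ-complete : ∀ p q → T (p ≤ᵇ q) → p ≤◇ q
≤ᵇ-complete A  A  _ = ε
≤ᵇ-complete A  B  _ = A⋖B ◅ ε
≤ᵇ-complete A  B' _ = A⋖B' ◅ ε
≤ᵇ-complete A  C  _ = A⋖B ◅ B⋖C ◅ ε
≤ᵇ-complete A  C' _ = A⋖B' ◅ B'⋖C' ◅ ε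
≤ᵇ-complete B  B  _ = ε
≤ᵇ-complete B  C  _ = B⋖C ◅ ε
≤ᵇ-complete B' B' _ = ε
≤ᵇ-complete B' C  _ = B'⋖C ◅ ε
≤ᵇ-complete B' C' _ = B'⋖C' ◅ ε
≤ᵇ-complete C  C  _ = ε
≤ᵇ-complete C' C' _ = ε
≤ᵇ-complete B  A  ()
≤ᵇ-complete B  B' ()
≤ᵇ-complete B  C' ()
≤ᵇ-complete B' A  ()
≤ᵇ-complete B' B  ()
≤ᵇ-complete C  A  ()
≤ᵇ-complete C  B  ()
≤ᵇ-complete C  B' ()
≤ᵇ-complete C  C' ()
≤ᵇ-complete C' A  ()
≤ᵇ-complete C' B  ()
≤ᵇ-complete C' B' ()
≤ᵇ-complete C' C  ()

≤ᵇ-antisym : ∀ p q → T (p ≤ᵇ q) → T (q ≤ᵇ p) → p ≡ q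
≤ᵇ-antisym A  A  _ _ = refl
≤ᵇ-antisym B  B  _ _ = refl
≤ᵇ-antisym B' B' _ _ = refl
≤ᵇ-antisym C  C  _ _ = refl
≤ᵇ-antisym C' C' _ _ = refl
≤ᵇ-antisym A  B  _ ()
≤ᵇ-antisym A  B' _ ()
≤ᵇ-antisym A  C  _ ()
≤ᵇ-antisym A  C' _ ()
≤ᵇ-antisym B  C  _ ()
≤ᵇ-antisym B' C  _ ()
≤ᵇ-antisym B' C' _ ()
≤ᵇ-antisym B  A  () _
≤ᵇ-antisym B  B' () _
≤ᵇ-antisym B  C' () _
≤ᵇ-antisym B' A  () _
≤ᵇ-antisym B' B  () _
≤ᵇ-antisym C  A  () _
≤ᵇ-antisym C  B  () _
≤ᵇ-antisym C  B' () _
≤ᵇ-antisym C  C' () _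
≤ᵇ-antisym C' A  () _
≤ᵇ-antisym C' B  () _
≤ᵇ-antisym C' B' () _
≤ᵇ-antisym C' C  () _

Realises : ∀ {n} → Bool → Subset n → Subset n → Set
Realises true  X Y = X ⊆ Y
Realises false X Y = ∃[ x ] x ∈ X × x ∉ Y

mkInducedCopy : ∀ {n} {F : Family n} (e : Dia' → Subset n) → (∀ p → e p ∈ₗ F) →
                (∀ p q → Realises (p ≤ᵇ q) (e p) (e q)) → InducedCopy F
mkInducedCopy e e∈F realise = record
  { emb      = e
  ; emb-∈    = e∈F
  ; emb-inj  = λ p q ep≡eq →
      ≤ᵇ-antisym p q (reflects p q (⊆-reflexive ep≡eq)) (reflects q p (⊆-reflexive (sym ep≡eq)))
  ; emb-mono = λ p q → included p q ∘ ≤ᵇ-sound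
  ; emb-refl = λ p q → ≤ᵇ-complete p q ∘ reflects p q
  }
  where
  included : ∀ p q → T (p ≤ᵇ q) → e p ⊆ e q
  included p q with p ≤ᵇ q | realise p q
  ... | true  | ep⊆eq = λ _ → ep⊆eq
  ... | false | _     = λ ()

  reflects : ∀ p q → e p ⊆ e q → T (p ≤ᵇ q)
  reflects p q with p ≤ᵇ q | realise p q
  ... | true  | _               = _
  ... | false | x , x∈ep , x∉eq = λ ep⊆eq → x∉eq (ep⊆eq x∈ep)

module _ {n} {F : Family n} (copy : InducedCopy F) where
  open InducedCopy copy

  emb-⊈ : ∀ {p q} → ¬ q ≤◇ p → emb q ⊈ emb p
  emb-⊈ q≰p eq⊆ep = q≰p (emb-refl _ _ eq⊆ep)

⊈⇒Nonempty : ∀ {n} {X Y : Subset n} → X ⊈ Y → Nonempty X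
⊈⇒Nonempty {X = X} X⊈Y with nonempty? X
... | yes X≢∅ = X≢∅
... | no  X≡∅ = ⊥-elim (X⊈Y (λ {x} x∈X → ⊥-elim (X≡∅ (x , x∈X))))

⁅⁆-injective : ∀ {n} {i j : Fin n} → ⁅ i ⁆ ≡ ⁅ j ⁆ → i ≡ j
⁅⁆-injective {i = i} {j} ⁅i⁆≡⁅j⁆ = x∈⁅y⁆⇒x≡y j (subst (i ∈_) ⁅i⁆≡⁅j⁆ (x∈⁅x⁆ i))

∈⇒⁅⁆⊆ : ∀ {n} {x : Fin n} {X} → x ∈ X → ⁅ x ⁆ ⊆ X
∈⇒⁅⁆⊆ {x = x} {X} x∈X y∈⁅x⁆ = subst (_∈ X) (sym (x∈⁅y⁆⇒x≡y x y∈⁅x⁆)) x∈X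

initial : ∀ {n} → ℕ → Subset n
initial {zero}  _       = []
initial {suc n} zero    = ∅
initial {suc n} (suc t) = inside ∷ initial t

∈-initial⁺ : ∀ {n t} {x : Fin n} → toℕ x < t → x ∈ initial t
∈-initial⁺ {t = suc t} {fzero}  _         = here
∈-initial⁺ {t = suc t} {fsuc x} (s≤s x<t) = there (∈-initial⁺ x<t)

∈-initial⁻ : ∀ {n t} {x : Fin n} → x ∈ initial t → toℕ x < t
∈-initial⁻ {suc n} {zero}           x∈∅           = ⊥-elim (∉∅ x∈∅)
∈-initial⁻ {suc n} {suc t} {fzero}  here          = s≤s z≤n
∈-initial⁻ {suc n} {suc t} {fsuc x} (there x∈init) = s≤s (∈-initial⁻ x∈init)

initial-mono : ∀ {n s t} → s ≤ t → initial {n} s ⊆ initial t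
initial-mono s≤t x∈ = ∈-initial⁺ (<-≤-trans (∈-initial⁻ x∈) s≤t)

initial-total : ∀ {n} s t → initial {n} s ⊆ initial t ⊎ initial {n} t ⊆ initial s
initial-total s t with ≤-total s t
... | inj₁ s≤t = inj₁ (initial-mono s≤t)
... | inj₂ t≤s = inj₂ (initial-mono t≤s)

initial-⊈ : ∀ {n s t} → s < t → s < n → initial {n} t ⊈ initial s
initial-⊈ {s = s} {t} s<t s<n init-t⊆init-s =
  <-irrefl refl (subst (_< s) (toℕ-fromℕ< s<n) (∈-initial⁻ (init-t⊆init-s s∈init-t)))
  where
  s∈init-t : fromℕ< s<n ∈ initial t
  s∈init-t = ∈-initial⁺ (subst (_< t) (sym (toℕ-fromℕ< s<n)) s<t)

initial≢⁅⁆ : ∀ {n t} {i : Fin n} → 1 < n → 2 ≤ t → initial t ≢ ⁅ i ⁆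
initial≢⁅⁆ {suc (suc n)} {i = i} (s≤s (s≤s z≤n)) 2≤t init≡⁅i⁆ =
  0≢1 (trans (is-i fzero (s≤s z≤n)) (sym (is-i (fsuc fzero) (s≤s (s≤s z≤n)))))
  where
  is-i : ∀ x → toℕ x < 2 → x ≡ i
  is-i x x<2 = x∈⁅y⁆⇒x≡y i (subst (x ∈_) init≡⁅i⁆ (∈-initial⁺ (<-≤-trans x<2 2≤t)))
  0≢1 : fzero ≢ fsuc fzero
  0≢1 ()

maximum : ∀ {n} {X : Subset n} → Nonempty X → ∃[ M ] M ∈ X × (∀ {x} → x ∈ X → toℕ x ≤ toℕ M)
maximum {X = _ ∷ X} (x , x∈) with nonempty? X
... | yes X≢∅ = let M , M∈X , M-max = maximum X≢∅ in
  fsuc M , there M∈X , λ { {fzero} _ → z≤n ; {fsuc y} (there y∈X) → s≤s (M-max y∈X) }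
maximum (fzero  , here)     | no X≡∅ =
  fzero , here , λ { {fzero} _ → z≤n ; {fsuc y} (there y∈X) → ⊥-elim (X≡∅ (y , y∈X)) }
maximum (fsuc x , there x∈) | no X≡∅ = ⊥-elim (X≡∅ (x , x∈))

data Shape {n} (X : Subset n) (M : Fin n) : Set where
  singleton : X ≡ ⁅ M ⁆ → Shape X M
  segment   : 0 < toℕ M → X ≡ initial (suc (toℕ M)) → Shape X M
  gapped    : ∀ {g h} → g ∈ X → toℕ g < toℕ M → toℕ h < toℕ M → h ∉ X → Shape X M

shape : ∀ {n} {X : Subset n} {M} → M ∈ X → (∀ {x} → x ∈ X → toℕ x ≤ toℕ M) → Shape X M
shape {X = X} {M} M∈X M-max with any? (λ g → g ∈? X ×-dec toℕ g ℕ.<? toℕ M)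
... | no ∄g = singleton (⊆-antisym X⊆⁅M⁆ (∈⇒⁅⁆⊆ M∈X))
  where
  X⊆⁅M⁆ : X ⊆ ⁅ M ⁆
  X⊆⁅M⁆ {x} x∈X with x ≟ M
  ... | yes refl = x∈⁅x⁆ M
  ... | no  x≢M  = ⊥-elim (∄g (x , x∈X , ≤∧≢⇒< (M-max x∈X) x≢M))
... | yes (g , g∈X , g<M) with any? (λ h → toℕ h ℕ.<? toℕ M ×-dec ¬? (h ∈? X))
...   | yes (h , h<M , h∉X) = gapped g∈X g<M h<M h∉X
...   | no ∄h = segment (<-≤-trans (s≤s z≤n) g<M) (⊆-antisym (∈-initial⁺ ∘ s≤s ∘ M-max) initial⊆X)
  where
  initial⊆X : initial (suc (toℕ M)) ⊆ X
  initial⊆X {x} x∈ with x ∈? X | x ≟ M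
  ... | yes x∈X | _        = x∈X
  ... | no  _   | yes refl = M∈X
  ... | no  x∉X | no  x≢M  = ⊥-elim (∄h (x , ≤∧≢⇒< (s≤s⁻¹ (∈-initial⁻ x∈)) x≢M , x∉X))

distinct-below⇒2≤ : ∀ {n} {g h M : Fin n} → toℕ g < toℕ M → toℕ h < toℕ M → g ≢ h → 2 ≤ toℕ M
distinct-below⇒2≤ {g = fzero}  {fzero}  _   _   g≢h = ⊥-elim (g≢h refl)
distinct-below⇒2≤ {g = fsuc _} {_}      g<M _   _   = ≤-trans (s≤s (s≤s z≤n)) g<M
distinct-below⇒2≤ {g = fzero}  {fsuc _} _   h<M _   = ≤-trans (s≤s (s≤s z≤n)) h<M

module Construction (m : ℕ) where

  n : ℕ
  n = suc m

  long-initial : ℕ → Subset n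
  long-initial k = initial (2 + k)

  segments : List (Subset n)
  segments = applyUpTo long-initial m

  singletons : List (Subset n)
  singletons = map ⁅_⁆ (allFin n)

  family : Family n
  family = ∅ ∷ singletons ++ segments

  ⁅⁆∈family : ∀ i → ⁅ i ⁆ ∈ₗ family
  ⁅⁆∈family i = Any.there (∈-++⁺ˡ (∈-map⁺ ⁅_⁆ (∈-allFin i)))

  initial∈family : ∀ {t} → 2 ≤ t → t ≤ n → initial t ∈ₗ family
  initial∈family {suc zero}    (s≤s ())
  initial∈family {suc (suc k)} _ (s≤s k<m) = Any.there (∈-++⁺ʳ singletons (∈-applyUpTo⁺ _ k<m))

  family-cases : ∀ {X} → X ∈ₗ family → X ≡ ∅ ⊎ ∃[ i ] X ≡ ⁅ i ⁆ ⊎ ∃[ t ] X ≡ initial t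
  family-cases (Any.here X≡∅) = inj₁ X≡∅
  family-cases (Any.there X∈) with ∈-++⁻ singletons X∈
  ... | inj₁ X∈singletons = let i , _ , X≡⁅i⁆ = ∈-map⁻ ⁅_⁆ {xs = allFin n} X∈singletons in
    inj₂ (inj₁ (i , X≡⁅i⁆))
  ... | inj₂ X∈segments   = let k , _ , X≡init = ∈-applyUpTo⁻ long-initial X∈segments in
    inj₂ (inj₂ (2 + k , X≡init))

  above-nonempty⇒initial : ∀ {Y Z} → Z ∈ₗ family → Y ⊆ Z → Nonempty Y → Z ⊈ Y → ∃[ t ] Z ≡ initial t
  above-nonempty⇒initial Z∈ Y⊆Z (y , y∈Y) Z⊈Y with family-cases Z∈
  ... | inj₁ refl               = ⊥-elim (∉∅ (Y⊆Z y∈Y))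
  ... | inj₂ (inj₁ (i , refl)) = ⊥-elim (Z⊈Y (∈⇒⁅⁆⊆ (subst (_∈ _) (x∈⁅y⁆⇒x≡y i (Y⊆Z y∈Y)) y∈Y)))
  ... | inj₂ (inj₂ initial-t)  = initial-t

  top-of-chain⇒initial : (copy : InducedCopy family) → ∀ q r → ¬ q ≤◇ A → ¬ r ≤◇ q → q ⋖ r →
                         ∃[ t ] InducedCopy.emb copy r ≡ initial t
  top-of-chain⇒initial copy q r q≰A r≰q q⋖r =
    above-nonempty⇒initial (emb-∈ r) (emb-mono q r (q⋖r ◅ ε))
                           (⊈⇒Nonempty (emb-⊈ copy q≰A)) (emb-⊈ copy r≰q)
    where open InducedCopy copy

  family-free : ¬ InducedCopy family
  family-free copy with top-of-chain⇒initial copy B C (≤ᵇ-sound {B} {A}) (≤ᵇ-sound {C} {B}) B⋖C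
                      | top-of-chain⇒initial copy B' C' (≤ᵇ-sound {B'} {A}) (≤ᵇ-sound {C'} {B'}) B'⋖C'
  ... | t , C↦t | t' , C'↦t' with initial-total {n} t t'
  ... | inj₁ t⊆t' = emb-⊈ copy (≤ᵇ-sound {C} {C'}) (subst₂ _⊆_ (sym C↦t) (sym C'↦t') t⊆t')
  ... | inj₂ t'⊆t = emb-⊈ copy (≤ᵇ-sound {C'} {C}) (subst₂ _⊆_ (sym C'↦t') (sym C↦t) t'⊆t)

  ∅∉singletons++segments : ∀ {X} → X ∈ₗ singletons ++ segments → ∅ ≢ X
  ∅∉singletons++segments X∈ ∅≡X with ∈-++⁻ singletons X∈
  ... | inj₁ X∈singletons = let i , _ , X≡⁅i⁆ = ∈-map⁻ ⁅_⁆ {xs = allFin n} X∈singletons in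
    ∉∅ (subst (i ∈_) (sym (trans ∅≡X X≡⁅i⁆)) (x∈⁅x⁆ i))
  ... | inj₂ X∈segments   = let k , _ , X≡init = ∈-applyUpTo⁻ long-initial X∈segments in
    ∉∅ (subst (fzero ∈_) (sym (trans ∅≡X X≡init)) (∈-initial⁺ (s≤s z≤n)))

  segments-unique : Unique segments
  segments-unique = applyUpTo⁺₁ _ m λ i<j j<m init≡init →
    initial-⊈ (s≤s (s≤s i<j)) (s≤s (≤-trans (s≤s i<j) j<m)) (⊆-reflexive (sym init≡init))

  singletons-disjoint-segments : Disjoint singletons segments
  singletons-disjoint-segments (X∈singletons , X∈segments)
    with ∈-map⁻ ⁅_⁆ {xs = allFin n} X∈singletons | ∈-applyUpTo⁻ long-initial X∈segments
  ... | i , _ , X≡⁅i⁆ | k , k<m , X≡init =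
    initial≢⁅⁆ (s≤s (≤-trans (s≤s z≤n) k<m)) (s≤s (s≤s z≤n)) (trans (sym X≡init) X≡⁅i⁆)

  family-unique : Unique family
  family-unique = All.tabulate ∅∉singletons++segments
                ∷ ++⁺ (map⁺ ⁅⁆-injective (allFin⁺ n)) segments-unique singletons-disjoint-segments

  family-length : length family ≡ 2 * n
  family-length = begin
    suc (length (singletons ++ segments))     ≡⟨ cong suc (length-++ singletons) ⟩
    suc (length singletons + length segments) ≡⟨ cong₂ (λ a b → suc (a + b))
                                                       length-singletons (length-applyUpTo _ m) ⟩
    suc (n + m)                               ≡⟨ arithmetic m ⟩
    2 * n                                     ∎
    where
    open ≡-Reasoning
    length-singletons : length singletons ≡ n
    length-singletons = trans (length-map ⁅_⁆ (allFin n)) (length-tabulate id)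
    arithmetic : ∀ m → suc (suc m + m) ≡ 2 * suc m
    arithmetic = solve-∀

  gapped-copy : ∀ {G M g h} → M ∈ G → g ∈ G → toℕ g < toℕ M → toℕ h < toℕ M → h ∉ G →
                InducedCopy (G ∷ family)
  gapped-copy {G} {M} {g} {h} M∈G g∈G g<M h<M h∉G = mkInducedCopy e e∈ realise
    where
    e : Dia' → Subset n
    e A  = ∅
    e B  = ⁅ M ⁆
    e B' = ⁅ g ⁆
    e C  = G
    e C' = initial (toℕ M)

    g≢h : g ≢ h
    g≢h refl = h∉G g∈G

    e∈ : ∀ p → e p ∈ₗ G ∷ family
    e∈ A  = Any.there (Any.here refl)
    e∈ B  = Any.there (⁅⁆∈family M)
    e∈ B' = Any.there (⁅⁆∈family g)
    e∈ C  = Any.here refl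
    e∈ C' = Any.there (initial∈family (distinct-below⇒2≤ g<M h<M g≢h) (<⇒≤ (toℕ<n M)))

    M∉⁅g⁆ : M ∉ ⁅ g ⁆
    M∉⁅g⁆ = x≢y⇒x∉⁅y⁆ (<⇒≢ g<M ∘ sym)
    g∉⁅M⁆ : g ∉ ⁅ M ⁆
    g∉⁅M⁆ = x≢y⇒x∉⁅y⁆ (<⇒≢ g<M)
    h∉⁅M⁆ : h ∉ ⁅ M ⁆
    h∉⁅M⁆ = x≢y⇒x∉⁅y⁆ (<⇒≢ h<M)
    h∉⁅g⁆ : h ∉ ⁅ g ⁆
    h∉⁅g⁆ = x≢y⇒x∉⁅y⁆ (g≢h ∘ sym)
    M∉below-M : M ∉ initial (toℕ M)
    M∉below-M = <-irrefl refl ∘ ∈-initial⁻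
    h∈below-M : h ∈ initial (toℕ M)
    h∈below-M = ∈-initial⁺ h<M

    realise : ∀ p q → Realises (p ≤ᵇ q) (e p) (e q)
    realise A  _  = ∅⊆
    realise B  A  = M , x∈⁅x⁆ M , ∉∅
    realise B  B  = ⊆-refl
    realise B  B' = M , x∈⁅x⁆ M , M∉⁅g⁆
    realise B  C  = ∈⇒⁅⁆⊆ M∈G
    realise B  C' = M , x∈⁅x⁆ M , M∉below-M
    realise B' A  = g , x∈⁅x⁆ g , ∉∅
    realise B' B  = g , x∈⁅x⁆ g , g∉⁅M⁆
    realise B' B' = ⊆-refl
    realise B' C  = ∈⇒⁅⁆⊆ g∈G
    realise B' C' = ∈⇒⁅⁆⊆ (∈-initial⁺ g<M)
    realise C  A  = M , M∈G , ∉∅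
    realise C  B  = g , g∈G , g∉⁅M⁆
    realise C  B' = M , M∈G , M∉⁅g⁆
    realise C  C  = ⊆-refl
    realise C  C' = M , M∈G , M∉below-M
    realise C' A  = h , h∈below-M , ∉∅
    realise C' B  = h , h∈below-M , h∉⁅M⁆
    realise C' B' = h , h∈below-M , h∉⁅g⁆
    realise C' C  = h , h∈below-M , h∉G
    realise C' C' = ⊆-refl

  family-saturated : ∀ G → G ∉ₗ family → InducedCopy (G ∷ family)
  family-saturated G G∉ with nonempty? G
  ... | no G-empty = ⊥-elim (G∉ (subst (_∈ₗ family) (sym (Empty-unique G-empty)) (Any.here refl)))
  ... | yes G-nonempty with maximum G-nonempty
  ... | M , M∈G , M-max with shape M∈G M-max
  ... | singleton G≡⁅M⁆         = ⊥-elim (G∉ (subst (_∈ₗ family) (sym G≡⁅M⁆) (⁅⁆∈family M)))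
  ... | segment 0<M G≡initial   =
    ⊥-elim (G∉ (subst (_∈ₗ family) (sym G≡initial) (initial∈family (s≤s 0<M) (toℕ<n M))))
  ... | gapped g∈G g<M h<M h∉G = gapped-copy M∈G g∈G g<M h<M h∉G

  family-saturating : InducedSaturating family
  family-saturating = record { distinct = family-unique ; free = family-free ; saturated = family-saturated }

proposition29 : (n : ℕ) → .{{_ : NonZero n}} →
    Σ (Family n) (λ F → InducedSaturating F × length F ≤ 2 * n)
proposition29 zero    = ⊥-elim-irr (≢-nonZero⁻¹ 0 refl)
proposition29 (suc m) = family , family-saturating , ≤-reflexive family-length
  where open Construction m
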